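{- Work in intensional Martin-Löf type theory with dependent sums, dependent products, intensional identity types and cumulative universes, assuming function extensionality. Fix a universe level $i$. The following two statements are logically equivalent: (P) If $\mathit{UA}_i \triangleq \prod_{A,B:U_i}(A\simeq B)\to A=B$ is inhabited, then for all $A,B:U_i$ the map $\mathit{idtoeqv} : (A=B)\to(A\simeq B)$ is an equivalence. (Q) If for all $A,B:U_i$ and $C : A\to B\to U_i$ we have $A = \sum_{a:A}1$, $\sum_{a:A}\sum_{b:B}C\,a\,b = \sum_{b:B}\sum_{a:A}C\,a\,b$, and $\mathit{isContr}(A)\to A = 1$ (i.e. the corresponding dependent product types are inhabited), then there exist terms $\mathit{unit} : \prod_{A:U_i}(A = \sum_{a:A}1)$ and $\mathit{flip} : \prod_{A,B:U_i}\prod_{C:A\to B\to U_i}(\sum_{a:A}\sum_{b:B}C\,a\,b = \sum_{b:B}\sum_{a:A}C\,a\,b)$ such that $\mathit{coerce}\;\mathit{unit}\;a = (a,*)$ and $\mathit{coerce}\;\mathit{flip}\;(a,b,c) = (b,a,c)$ for all $a:A$, $b:B$, $c:C\,a\,b$.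
   Context: $1$ is the unit type with element $*$. $\mathit{isContr}(A)\triangleq\sum_{a_0:A}\prod_{a:A}(a_0=a)$; $\mathit{fib}_f(b)\triangleq\sum_{a:A}(f\,a=b)$; $\mathit{isEquiv}(f)\triangleq\prod_{b:B}\mathit{isContr}(\mathit{fib}_f(b))$; $A\simeq B\triangleq\sum_{f:A\to B}\mathit{isEquiv}(f)$. $\mathit{idtoeqv}$ is defined by path induction sending $\mathit{refl}$ to the identity equivalence, and $\mathit{coerce}(p)$ is the underlying function of $\mathit{idtoeqv}(p)$. -}

{-# OPTIONS --without-K #-}
module Defs where

open import Level using (Level; _⊔_; suc; Setω)
open import Data.Product using (Σ; _×_; _,_; proj₁; proj₂)
open import Data.Unit.Polymorphic using (⊤; tt)
open import Relation.Binary.PropositionalEquality using (_≡_; refl)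
open import Axiom.Extensionality.Propositional using (Extensionality)
open import Function.Bundles using (_⇔_)

isContr : ∀ {ℓ} → Set ℓ → Set ℓ
isContr A = Σ A (λ a₀ → (a : A) → a₀ ≡ a)

fib : ∀ {ℓ ℓ'} {A : Set ℓ} {B : Set ℓ'} → (A → B) → B → Set (ℓ ⊔ ℓ')
fib {A = A} f b = Σ A (λ a → f a ≡ b)

isEquiv : ∀ {ℓ ℓ'} {A : Set ℓ} {B : Set ℓ'} → (A → B) → Set (ℓ ⊔ ℓ')
isEquiv {B = B} f = (b : B) → isContr (fib f b)

_≃_ : ∀ {ℓ ℓ'} → Set ℓ → Set ℓ' → Set (ℓ ⊔ ℓ')
A ≃ B = Σ (A → B) isEquiv

idIsEquiv : ∀ {ℓ} (A : Set ℓ) → isEquiv (λ (a : A) → a)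
idIsEquiv A b = (b , refl) , λ { (a , refl) → refl }

idEquiv : ∀ {ℓ} (A : Set ℓ) → A ≃ A
idEquiv A = (λ a → a) , idIsEquiv A

idtoeqv : ∀ {ℓ} {A B : Set ℓ} → A ≡ B → A ≃ B
idtoeqv {A = A} refl = idEquiv A

coerce : ∀ {ℓ} {A B : Set ℓ} → A ≡ B → A → B
coerce p = proj₁ (idtoeqv p)

FunExt : Setω
FunExt = ∀ {a b} → Extensionality a b

UA : (i : Level) → Set (suc i)
UA i = (A B : Set i) → A ≃ B → A ≡ B

StatementP : (i : Level) → Set (suc i)
StatementP i = UA i → (A B : Set i) → isEquiv (idtoeqv {A = A} {B = B})

UnitTy : (i : Level) → Set (suc i)
UnitTy i = (A : Set i) → A ≡ Σ A (λ _ → ⊤ {i})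

FlipTy : (i : Level) → Set (suc i)
FlipTy i = (A B : Set i) (C : A → B → Set i) →
  Σ A (λ a → Σ B (λ b → C a b)) ≡ Σ B (λ b → Σ A (λ a → C a b))

ContrTy : (i : Level) → Set (suc i)
ContrTy i = (A : Set i) → isContr A → A ≡ ⊤ {i}

StatementQ : (i : Level) → Set (suc i)
StatementQ i = UnitTy i → FlipTy i → ContrTy i →
  Σ (UnitTy i) (λ unit → Σ (FlipTy i) (λ flip →
    (((A : Set i) (a : A) → coerce (unit A) a ≡ (a , tt))
    × ((A B : Set i) (C : A → B → Set i) (a : A) (b : B) (c : C a b) →
          coerce (flip A B C) (a , b , c) ≡ (b , a , c)))))

{-# OPTIONS --without-K #-}
-- From unit, flip and "contractible types are 1", every equivalence f : A → B yields a path
--   A = Σ a:A. 1 = Σ a:A. Σ b:B. f a = b = Σ b:B. Σ a:A. f a = b = Σ b:B. 1 = B,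
-- and when unit and flip compute as in (Q), coercion along it is f: the second and fourth
-- steps only change contractible fibres, so they cannot move a point anywhere else.
-- (P ⇒ Q): the path is a proof of UA, so idtoeqv is an equivalence, and the preimages of the
-- canonical equivalences a ↦ (a , *) and (a , b , c) ↦ (b , a , c) are the required unit and flip.
-- (Q ⇒ P): UA supplies the three hypotheses of (Q); the computing unit and flip it returns make
-- the path a section of idtoeqv, so Σ B. A ≃ B is a retract of the contractible Σ B. A = B,
-- and a fibrewise map between contractible total spaces is a fibrewise equivalence.
module Submission where

open import Defs
open import Level using (Level; suc)
open import Function.Base using (_$_)
open import Function.Bundles using (_⇔_; mk⇔)
open import Data.Product using (Σ; _×_; _,_; proj₁; proj₂)
open import Data.Product.Properties using (Σ-≡,≡→≡)
open import Data.Unit.Polymorphic using (⊤; tt)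
open import Relation.Binary.PropositionalEquality
open import Relation.Nullary.Irrelevant using (Irrelevant)
open import Axiom.UniquenessOfIdentityProofs using (UIP; module Constant⇒UIP)

private
  variable
    ℓ ℓ′ ℓ″ : Level

isContr⇒Irrelevant : {A : Set ℓ} → isContr A → Irrelevant A
isContr⇒Irrelevant (c , h) x y = trans (sym (h x)) (h y)

Irrelevant⇒UIP : {A : Set ℓ} → Irrelevant A → UIP A
Irrelevant⇒UIP irr = Constant⇒UIP.≡-irrelevant (λ {x} {y} _ → irr x y) (λ _ _ → refl)

isContr-singleton : {A : Set ℓ} (a : A) → isContr (Σ A (a ≡_))
isContr-singleton a = (a , refl) , λ { (b , refl) → refl }

isContr-retract : {A : Set ℓ} {B : Set ℓ′} (r : A → B) (s : B → A) →
                  (∀ b → r (s b) ≡ b) → isContr A → isContr B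
isContr-retract r s rs (c , h) = r c , λ b → trans (cong r (h (s b))) (rs b)

isContr⇒isEquiv : {A : Set ℓ} {B : Set ℓ′} (f : A → B) → isContr A → isContr B → isEquiv f
isContr⇒isEquiv f (c , h) contrB b =
  (c , irrB _ _) , λ (a , α) → Σ-≡,≡→≡ (h a , Irrelevant⇒UIP irrB _ _)
  where
  irrB : Irrelevant _
  irrB = isContr⇒Irrelevant contrB

module _ (fe : FunExt) where

  isContr-Irrelevant : {A : Set ℓ} → Irrelevant (isContr A)
  isContr-Irrelevant contrA@(_ , h) (c′ , _) =
    Σ-≡,≡→≡ (h c′ , fe λ _ → Irrelevant⇒UIP (isContr⇒Irrelevant contrA) _ _)

  isEquiv-Irrelevant : {A : Set ℓ} {B : Set ℓ′} (f : A → B) → Irrelevant (isEquiv f)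
  isEquiv-Irrelevant f e e′ = fe λ b → isContr-Irrelevant (e b) (e′ b)

  ≃-≡ : {A : Set ℓ} {B : Set ℓ′} {e e′ : A ≃ B} → proj₁ e ≡ proj₁ e′ → e ≡ e′
  ≃-≡ p = Σ-≡,≡→≡ (p , isEquiv-Irrelevant _ _ _)

total : {X : Set ℓ} {P : X → Set ℓ′} {Q : X → Set ℓ″} →
        (∀ x → P x → Q x) → Σ X P → Σ X Q
total f (x , p) = x , f x p

isEquiv-total⇒isEquiv : {X : Set ℓ} {P : X → Set ℓ′} {Q : X → Set ℓ″}
                        (f : ∀ x → P x → Q x) → isEquiv (total f) → ∀ x → isEquiv (f x)
isEquiv-total⇒isEquiv f equiv x q = isContr-retract r s rs (equiv (x , q))
  where
  r : ∀ {w} → fib (total f) w → fib (f (proj₁ w)) (proj₂ w)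
  r ((_ , p) , refl) = p , refl

  s : fib (f x) q → fib (total f) (x , q)
  s (p , α) = (x , p) , cong (x ,_) α

  rs : ∀ y → r (s y) ≡ y
  rs (_ , refl) = refl

fibrewise-section⇒isEquiv : {X : Set ℓ} {a : X} {Q : X → Set ℓ′}
                            (f : ∀ x → a ≡ x → Q x) (s : ∀ x → Q x → a ≡ x) →
                            (∀ x q → f x (s x q) ≡ q) → ∀ x → isEquiv (f x)
fibrewise-section⇒isEquiv {a = a} f s fs = isEquiv-total⇒isEquiv f $
  isContr⇒isEquiv (total f) (isContr-singleton a) $
  isContr-retract (total f) (total s) (λ (x , q) → cong (x ,_) (fs x q)) (isContr-singleton a)

Σ-⊤-≃ : ∀ {i} (A : Set i) → A ≃ Σ A (λ _ → ⊤ {i})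
Σ-⊤-≃ A = (λ a → a , tt) , λ { (a , tt) → (a , refl) , λ { (_ , refl) → refl } }

Σ-comm-≃ : ∀ {i} (A B : Set i) (C : A → B → Set i) →
           Σ A (λ a → Σ B (λ b → C a b)) ≃ Σ B (λ b → Σ A (λ a → C a b))
Σ-comm-≃ A B C = (λ (a , b , c) → b , a , c) ,
  λ (b , a , c) → ((a , b , c) , refl) , λ { (_ , refl) → refl }

isContr⇒≃⊤ : ∀ {i} (A : Set i) → isContr A → A ≃ ⊤ {i}
isContr⇒≃⊤ A (c , h) = (λ _ → tt) , λ _ → (c , refl) , λ { (a , refl) → cong (_, refl) (h a) }

≃⇒≡-coerce : {A B : Set ℓ} → isEquiv (idtoeqv {A = A} {B = B}) →
             (e : A ≃ B) → Σ (A ≡ B) (λ p → coerce p ≡ proj₁ e)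
≃⇒≡-coerce equiv e = let ((p , α) , _) = equiv e in p , cong proj₁ α

coerce-trans : {A B C : Set ℓ} (p : A ≡ B) {q : B ≡ C} {x : A} {y : B} {z : C} →
               coerce p x ≡ y → coerce q y ≡ z → coerce (trans p q) x ≡ z
coerce-trans refl refl β = β

coerce-sym : {A B : Set ℓ} (p : A ≡ B) {x : A} {y : B} → coerce p x ≡ y → coerce (sym p) y ≡ x
coerce-sym refl refl = refl

coerce-cong-Σ-Irrelevant : {A : Set ℓ} {P Q : A → Set ℓ} (p : P ≡ Q) {a : A} {t : P a} {t′ : Q a} →
                           Irrelevant (Q a) → coerce (cong (Σ A) p) (a , t) ≡ (a , t′)
coerce-cong-Σ-Irrelevant refl {a} irr = cong (a ,_) (irr _ _)

UnitComputes : ∀ {i} → UnitTy i → Set (suc i)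
UnitComputes {i} unit = (A : Set i) (a : A) → coerce (unit A) a ≡ (a , tt)

FlipComputes : ∀ {i} → FlipTy i → Set (suc i)
FlipComputes {i} flip = (A B : Set i) (C : A → B → Set i) (a : A) (b : B) (c : C a b) →
                        coerce (flip A B C) (a , b , c) ≡ (b , a , c)

ComputingUnitFlip : (i : Level) → Set (suc i)
ComputingUnitFlip i = Σ (UnitTy i) λ unit → Σ (FlipTy i) λ flip → UnitComputes unit × FlipComputes flip

module Univalence (fe : FunExt) {i : Level} (unit : UnitTy i) (flip : FlipTy i) (contr : ContrTy i) where

  module _ {A B : Set i} (f : A → B) (equiv : isEquiv f) where

    fibres-over-dom : (λ _ → ⊤) ≡ (λ a → Σ B (λ b → f a ≡ b))
    fibres-over-dom = fe λ a → sym (contr _ (isContr-singleton (f a)))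

    fibres-over-cod : (λ b → Σ A (λ a → f a ≡ b)) ≡ (λ _ → ⊤)
    fibres-over-cod = fe λ b → contr _ (equiv b)

    isEquiv⇒≡ : A ≡ B
    isEquiv⇒≡ = begin
      A                                   ≡⟨ unit A ⟩
      Σ A (λ _ → ⊤)                       ≡⟨ cong (Σ A) fibres-over-dom ⟩
      Σ A (λ a → Σ B (λ b → f a ≡ b))     ≡⟨ flip A B (λ a b → f a ≡ b) ⟩
      Σ B (λ b → Σ A (λ a → f a ≡ b))     ≡⟨ cong (Σ B) fibres-over-cod ⟩
      Σ B (λ _ → ⊤)                       ≡⟨ sym (unit B) ⟩
      B                                   ∎
      where open ≡-Reasoning

    module _ (unitβ : UnitComputes unit) (flipβ : FlipComputes flip) where

      coerce-isEquiv⇒≡ : (a : A) → coerce isEquiv⇒≡ a ≡ f a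
      coerce-isEquiv⇒≡ a =
        coerce-trans (unit A) (unitβ A a) $
        coerce-trans (cong (Σ A) fibres-over-dom)
          (coerce-cong-Σ-Irrelevant fibres-over-dom (isContr⇒Irrelevant (isContr-singleton (f a)))) $
        coerce-trans (flip A B _) (flipβ A B (λ a b → f a ≡ b) a (f a) refl) $
        coerce-trans (cong (Σ B) fibres-over-cod) (coerce-cong-Σ-Irrelevant fibres-over-cod (λ _ _ → refl)) $
        coerce-trans (sym (unit B)) (coerce-sym (unit B) (unitβ B (f a))) refl

      idtoeqv-isEquiv⇒≡ : idtoeqv isEquiv⇒≡ ≡ (f , equiv)
      idtoeqv-isEquiv⇒≡ = ≃-≡ fe (fe coerce-isEquiv⇒≡)

  ua : UA i
  ua A B (f , equiv) = isEquiv⇒≡ f equiv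

P⇒Q : FunExt → (i : Level) → StatementP i → StatementQ i
P⇒Q fe i P unit flip contr =
  (λ A → proj₁ (unit≡ A)) , (λ A B C → proj₁ (flip≡ A B C)) ,
  (λ A a → cong-app (proj₂ (unit≡ A)) a) ,
  (λ A B C a b c → cong-app (proj₂ (flip≡ A B C)) (a , b , c))
  where
  idtoeqv-isEquiv : (A B : Set i) → isEquiv (idtoeqv {A = A} {B = B})
  idtoeqv-isEquiv = P (Univalence.ua fe unit flip contr)

  unit≡ : (A : Set i) → Σ (A ≡ Σ A (λ _ → ⊤)) λ p → coerce p ≡ proj₁ (Σ-⊤-≃ A)
  unit≡ A = ≃⇒≡-coerce (idtoeqv-isEquiv _ _) (Σ-⊤-≃ A)

  flip≡ : (A B : Set i) (C : A → B → Set i) →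
          Σ (Σ A (λ a → Σ B (C a)) ≡ Σ B (λ b → Σ A (λ a → C a b))) λ p → coerce p ≡ proj₁ (Σ-comm-≃ A B C)
  flip≡ A B C = ≃⇒≡-coerce (idtoeqv-isEquiv _ _) (Σ-comm-≃ A B C)

ComputingUnitFlip⇒isEquiv-idtoeqv : FunExt → ∀ {i} → ContrTy i → ComputingUnitFlip i →
                                    (A B : Set i) → isEquiv (idtoeqv {A = A} {B = B})
ComputingUnitFlip⇒isEquiv-idtoeqv fe contr (unit , flip , unitβ , flipβ) A =
  fibrewise-section⇒isEquiv (λ _ → idtoeqv) (λ _ (f , equiv) → isEquiv⇒≡ f equiv)
                            (λ _ (f , equiv) → idtoeqv-isEquiv⇒≡ f equiv unitβ flipβ)
  where open Univalence fe unit flip contr using (isEquiv⇒≡; idtoeqv-isEquiv⇒≡)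

Q⇒P : FunExt → (i : Level) → StatementQ i → StatementP i
Q⇒P fe i Q ua = ComputingUnitFlip⇒isEquiv-idtoeqv fe contr
                  (Q (λ A → ua _ _ (Σ-⊤-≃ A)) (λ A B C → ua _ _ (Σ-comm-≃ A B C)) contr)
  where
  contr : ContrTy i
  contr A c = ua _ _ (isContr⇒≃⊤ A c)

theorem6p4 : FunExt → (i : Level) → StatementP i ⇔ StatementQ i
theorem6p4 fe i = mk⇔ (P⇒Q fe i) (Q⇒P fe i)
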